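{- Let $G$ be a biconnected graph, let $S$ be a single cutset of $G$, and let $x\in S$. Then: (1) If $d_{\mathrm{BT}(G)}(S)=d$, then $d_G(x)\ge d$; and if $d_G(x)=d$, then the two vertices of $S$ are not adjacent in $G$. (2) $d_G(x)\ge 3$.
   Context: All graphs are finite, undirected, without loops or multiple edges; $d_H(v)$ is the degree of $v$ in $H$. A connected component means the vertex set of a maximal connected subgraph. A set $R\subset V(G)$ is a cutset if $G-R$ (delete the vertices of $R$) is disconnected; $\mathfrak R_2(G)$ is the set of 2-vertex cutsets. $R$ separates $X$ from $Y$ (where $X,Y\not\subset R$) if no vertex of $X\setminus R$ and no vertex of $Y\setminus R$ lie in a common connected component of $G-R$; $R$ splits $X$ if $X\setminus R$ is not contained in one connected component of $G-R$. $G$ is biconnected if $v(G)>2$ and $G$ has no cutset with at most one vertex. Cutsets $S,T\in\mathfrak R_2(G)$ are independent if neither splits the other. A cutset $S\in\mathfrak R_2(G)$ is single if it is independent with all other cutsets in $\mathfrak R_2(G)$; $\mathfrak O(G)$ is the set of single cutsets. For a set $\mathfrak S$ of cutsets, a set $A\subset V(G)$ is a part of the $\mathfrak S$-decomposition if no cutset of $\mathfrak S$ splits $A$ but every vertex outside $A$ is separated from $A$ by some cutset of $\mathfrak S$; $\mathrm{Part}(\mathfrak S)$ is the set of such parts. $\mathrm{BT}(G)$ is the bipartite graph whose vertices are the cutsets in $\mathfrak O(G)$ and the parts in $\mathrm{Part}(\mathfrak O(G))$, with a cutset $S$ adjacent to a part $A$ iff $S\subset A$. -}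

module Defs where

open import Data.Nat using (ℕ; _≤_; _<_)
open import Data.Fin using (Fin)
open import Data.Fin.Subset using (Subset; _∈_; _∉_; _⊆_; ∣_∣; ⁅_⁆)
open import Data.List using (List; length; filter; allFin)
open import Data.List.Relation.Unary.All using (All)
open import Data.List.Relation.Unary.Unique.Propositional using (Unique)
import Data.List.Membership.Propositional as LM
open import Data.Product using (Σ; _×_; ∃; ∃-syntax)
open import Relation.Nullary using (¬_; Dec)
open import Relation.Binary.PropositionalEquality using (_≡_; _≢_)

record Graph (n : ℕ) : Set₁ where
  field
    Adj      : Fin n → Fin n → Set
    adj?     : ∀ u v → Dec (Adj u v)
    symmetric : ∀ {u v} → Adj u v → Adj v u
    irreflexive : ∀ {u} → ¬ Adj u u

module _ {n : ℕ} (G : Graph n) where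
  open Graph G

  degree : Fin n → ℕ
  degree x = length (filter (adj? x) (allFin n))

  -- Reach R u v : u and v lie in a common connected component of G - R
  data Reach (R : Subset n) : Fin n → Fin n → Set where
    here : ∀ {u} → u ∉ R → Reach R u u
    step : ∀ {u w v} → u ∉ R → Adj u w → Reach R w v → Reach R u v

  Cutset : Subset n → Set
  Cutset R = ∃[ u ] ∃[ v ] (u ∉ R × v ∉ R × ¬ Reach R u v)

  Cutset2 : Subset n → Set
  Cutset2 R = Cutset R × ∣ R ∣ ≡ 2

  Separates : Subset n → Subset n → Subset n → Set
  Separates R X Y = ¬ (X ⊆ R) × ¬ (Y ⊆ R) ×
    (∀ u v → u ∈ X → u ∉ R → v ∈ Y → v ∉ R → ¬ Reach R u v)

  Splits : Subset n → Subset n → Set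
  Splits R X = ∃[ u ] ∃[ v ] (u ∈ X × u ∉ R × v ∈ X × v ∉ R × ¬ Reach R u v)

  Biconnected : Set
  Biconnected = 2 < n × (∀ R → ∣ R ∣ ≤ 1 → ¬ Cutset R)

  Independent : Subset n → Subset n → Set
  Independent S T = ¬ Splits S T × ¬ Splits T S

  Single : Subset n → Set
  Single S = Cutset2 S × (∀ T → Cutset2 T → T ≢ S → Independent S T)

  IsPart : (Subset n → Set) → Subset n → Set
  IsPart 𝔖 A = (∀ S → 𝔖 S → ¬ Splits S A) ×
               (∀ v → v ∉ A → ∃[ S ] (𝔖 S × Separates S A ⁅ v ⁆))

  HasCard : (Subset n → Set) → ℕ → Set
  HasCard P d = Σ (List (Subset n)) λ xs →
    length xs ≡ d × Unique xs × All P xs × (∀ A → P A → A LM.∈ xs)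

  -- d_{BT(G)}(S) = d  (for S ∈ 𝔒(G)): S is adjacent in BT(G) exactly to the
  -- parts A ∈ Part(𝔒(G)) with S ⊆ A
  BTDegree : Subset n → ℕ → Set
  BTDegree S d = HasCard (λ A → IsPart Single A × S ⊆ A) d

module Submission where

-- Let S = {x, y} be a single 2-cutset of the biconnected graph G.
--
-- G − y is connected, so every vertex u outside S reaches x in
-- G − y; the last vertex before x on such a path is a neighbour z of x outside S
-- lying in the component of u in G − S (`escape`, `attachment`).
--
-- (2) The two sides of the cutset S give two distinct neighbours zu, zv of x
-- outside S.  If x had degree at most 2, all neighbours of x (y included) would
-- lie in T = {zu, zv}, so T would be a 2-cutset separating x from y, i.e. splitting
-- S, contradicting that S is single.
--
-- (1) The BT-neighbours of S are the parts A ⊇ S.  A general fact about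
-- decompositions (`part-⊆`) shows that two such parts meeting a common component
-- of G − S coincide.  Hence choosing an attachment for every part A ≠ S gives
-- distinct neighbours of x outside S; and if S itself is a part, it is the only
-- BT-neighbour and the two neighbours from (2) suffice.  So d is at most the number
-- of neighbours of x outside S, and y is one neighbour more when x ~ y.
--
-- Reachability is not decided here, so these arguments run in the double-negation
-- monad and are concluded by the decidability of ≤ on ℕ.

open import Defs

open import Level using (0ℓ)
open import Data.Bool using () renaming (_≟_ to _≟ᵇ_)
open import Data.Empty using (⊥; ⊥-elim)
open import Data.Fin using (Fin)
open import Data.Fin.Properties using (¬∀⟶∃¬) renaming (_≟_ to _≟ᶠ_)
open import Data.Fin.Subset using (Subset; _∈_; _∉_; _⊆_; ∣_∣; ⁅_⁆; _∪_)
open import Data.Fin.Subset.Properties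
  using (_∈?_; _⊆?_; ⊆-antisym; x∈⁅x⁆; x∈⁅y⁆⇒x≡y; x≢y⇒x∉⁅y⁆; ∣⁅x⁆∣≡1; ∪-identityˡ; ∪-identityʳ;
         x∈p∪q⁺; x∈p∪q⁻; p⊆q⇒∣p∣≤∣q∣; p⊂q⇒∣p∣<∣q∣)
open import Data.List using (List; []; _∷_; length; _++_)
open import Data.List.Properties using (length-++)
open import Data.List.Relation.Unary.All as All using (All; []; _∷_)
open import Data.List.Relation.Unary.AllPairs using ([]; _∷_)
open import Data.List.Relation.Unary.Unique.Propositional using (Unique)
open import Data.List.Relation.Unary.Any using (here; there)
import Data.List.Membership.Propositional as List
import Data.List.Membership.DecPropositional as DecList
open import Data.List.Membership.Propositional.Properties
  using (∈-∃++; ∈-++⁻; ∈-++⁺ˡ; ∈-++⁺ʳ; ∈-filter⁺; ∈-allFin)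
open import Data.Nat using (ℕ; suc; _≤_; _<_; z≤n; s≤s; _≤?_)
open import Data.Nat.Properties using (≤-reflexive; ≤-trans; +-suc; <⇒≢; <⇒≱)
open import Data.Product using (Σ; _×_; ∃; ∃-syntax; _,_; proj₁; proj₂)
open import Data.Sum using (_⊎_; inj₁; inj₂)
open import Data.Vec.Properties using (≡-dec)
open import Effect.Monad using (RawMonad)
open import Relation.Nullary using (¬_; yes; no)
open import Relation.Nullary.Decidable using (decidable-stable; _→-dec_)
open import Relation.Nullary.Negation using (¬¬-Monad)
open import Relation.Binary.PropositionalEquality using (_≡_; _≢_; refl; sym; trans; cong; subst; subst₂)

open RawMonad (¬¬-Monad {0ℓ})

unique-⊆-length : ∀ {A : Set} {xs ys : List A} → Unique xs →
  (∀ {z} → z List.∈ xs → z List.∈ ys) → length xs ≤ length ys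
unique-⊆-length {xs = []} _ _ = z≤n
unique-⊆-length {xs = x ∷ xs} {ys} (x∉xs ∷ xs-unique) xs⊆ys
  with ys₁ , ys₂ , refl ← ∈-∃++ (xs⊆ys (here refl))
  rewrite length-++ ys₁ {x ∷ ys₂} | +-suc (length ys₁) (length ys₂) =
  s≤s (subst (length xs ≤_) (length-++ ys₁) (unique-⊆-length xs-unique xs⊆ys₁++ys₂))
  where
  xs⊆ys₁++ys₂ : ∀ {w} → w List.∈ xs → w List.∈ ys₁ ++ ys₂
  xs⊆ys₁++ys₂ w∈xs with ∈-++⁻ ys₁ (xs⊆ys (there w∈xs))
  ... | inj₁ w∈ys₁ = ∈-++⁺ˡ w∈ys₁
  ... | inj₂ (here w≡x) = ⊥-elim (All.lookup x∉xs w∈xs (sym w≡x))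
  ... | inj₂ (there w∈ys₂) = ∈-++⁺ʳ ys₁ w∈ys₂

unique-constant-length : ∀ {A : Set} {c : A} {xs : List A} → Unique xs → All (_≡ c) xs →
  length xs ≤ 1
unique-constant-length [] _ = z≤n
unique-constant-length (_ ∷ []) _ = s≤s z≤n
unique-constant-length ((x≢x' ∷ _) ∷ _) (x≡c ∷ x'≡c ∷ _) = ⊥-elim (x≢x' (trans x≡c (sym x'≡c)))

witness-list : ∀ {A B : Set} (W : A → B → Set) → (∀ {a a' b} → W a b → W a' b → a ≡ a') →
  ∀ {as} → Unique as → All (λ a → ∃ (W a)) as →
  Σ (List B) λ bs → Unique bs × All (λ b → ∃ λ a → a List.∈ as × W a b) bs × length bs ≡ length as
witness-list W injective [] [] = [] , [] , [] , refl
witness-list W injective {_ ∷ as} (a∉as ∷ as-unique) ((b , wab) ∷ witnesses)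
  with bs , bs-unique , bs-witnessed , bs-length ← witness-list W injective as-unique witnesses =
  b ∷ bs , All.map fresh bs-witnessed ∷ bs-unique ,
  (_ , here refl , wab) ∷ All.map (λ (a' , a'∈as , wa'b') → a' , there a'∈as , wa'b') bs-witnessed ,
  cong suc bs-length
  where
  fresh : ∀ {b'} → ∃ (λ a' → a' List.∈ as × W a' b') → b ≢ b'
  fresh (a' , a'∈as , wa'b') refl = All.lookup a∉as a'∈as (injective wab wa'b')

⊈⇒∃ : ∀ {n} {p q : Subset n} → ¬ (p ⊆ q) → ∃[ i ] (i ∈ p × i ∉ q)
⊈⇒∃ {n} {p} {q} p⊈q
  with i , ¬[i∈p⇒i∈q] ←
         ¬∀⟶∃¬ n (λ i → i ∈ p → i ∈ q) (λ i → (i ∈? p) →-dec (i ∈? q)) (λ f → p⊈q (f _)) =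
  i , decidable-stable (i ∈? p) (λ i∉p → ¬[i∈p⇒i∈q] (λ i∈p → ⊥-elim (i∉p i∈p))) ,
  λ i∈q → ¬[i∈p⇒i∈q] (λ _ → i∈q)

⊆-card⇒⊇ : ∀ {n} {p q : Subset n} → p ⊆ q → ∣ q ∣ ≤ ∣ p ∣ → q ⊆ p
⊆-card⇒⊇ {p = p} p⊆q ∣q∣≤∣p∣ {i} i∈q with i ∈? p
... | yes i∈p = i∈p
... | no i∉p = ⊥-elim (<⇒≱ (p⊂q⇒∣p∣<∣q∣ (p⊆q , i , i∈q , i∉p)) ∣q∣≤∣p∣)

∣pair∣≡2 : ∀ {n} (a b : Fin n) → a ≢ b → ∣ ⁅ a ⁆ ∪ ⁅ b ⁆ ∣ ≡ 2
∣pair∣≡2 Fin.zero Fin.zero a≢b = ⊥-elim (a≢b refl)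
∣pair∣≡2 Fin.zero (Fin.suc b) _ rewrite ∪-identityˡ ⁅ b ⁆ | ∣⁅x⁆∣≡1 b = refl
∣pair∣≡2 (Fin.suc a) Fin.zero _ rewrite ∪-identityʳ ⁅ a ⁆ | ∣⁅x⁆∣≡1 a = refl
∣pair∣≡2 (Fin.suc a) (Fin.suc b) a≢b = ∣pair∣≡2 a b (λ a≡b → a≢b (cong Fin.suc a≡b))

∈pair⇒ : ∀ {n} {a b z : Fin n} → z ∈ ⁅ a ⁆ ∪ ⁅ b ⁆ → z ≡ a ⊎ z ≡ b
∈pair⇒ {a = a} {b} z∈ab with x∈p∪q⁻ ⁅ a ⁆ ⁅ b ⁆ z∈ab
... | inj₁ z∈a = inj₁ (x∈⁅y⁆⇒x≡y a z∈a)
... | inj₂ z∈b = inj₂ (x∈⁅y⁆⇒x≡y b z∈b)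

module GraphFacts {n : ℕ} (G : Graph n) where
  open Graph G

  reach-start : ∀ {R u v} → Reach G R u v → u ∉ R
  reach-start (here u∉R) = u∉R
  reach-start (step u∉R _ _) = u∉R

  reach-end : ∀ {R u v} → Reach G R u v → v ∉ R
  reach-end (here v∉R) = v∉R
  reach-end (step _ _ w↝v) = reach-end w↝v

  reach-trans : ∀ {R u v w} → Reach G R u v → Reach G R v w → Reach G R u w
  reach-trans (here _) v↝w = v↝w
  reach-trans (step u∉R u~u' u'↝v) v↝w = step u∉R u~u' (reach-trans u'↝v v↝w)

  reach-sym : ∀ {R u v} → Reach G R u v → Reach G R v u
  reach-sym (here u∉R) = here u∉R
  reach-sym (step u∉R u~w w↝v) =
    reach-trans (reach-sym w↝v) (step (reach-start w↝v) (symmetric u~w) (here u∉R))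

  reach-mono : ∀ {R T u v} → T ⊆ R → Reach G R u v → Reach G T u v
  reach-mono T⊆R (here u∉R) = here (λ u∈T → u∉R (T⊆R u∈T))
  reach-mono T⊆R (step u∉R u~w w↝v) = step (λ u∈T → u∉R (T⊆R u∈T)) u~w (reach-mono T⊆R w↝v)

  enclosed-unreachable : ∀ {T a b} → a ≢ b → (∀ w → Adj a w → w ∈ T) → ¬ Reach G T a b
  enclosed-unreachable a≢b _ (here _) = a≢b refl
  enclosed-unreachable _ N⊆T (step {w = w} _ a~w w↝b) = reach-start w↝b (N⊆T w a~w)

  -- Cutting a path from u to x in G − T just before x: if S ⊆ {x} ∪ T contains x
  -- but not u, some neighbour of x is reached from u in G − S.
  escape : ∀ {S T u x} → x ∈ S → S ⊆ ⁅ x ⁆ ∪ T → u ∉ S → Reach G T u x →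
    ∃[ z ] (Adj x z × Reach G S u z)
  escape x∈S _ u∉S (here _) = ⊥-elim (u∉S x∈S)
  escape {S} {T} {u} {x} x∈S S⊆x∪T u∉S (step {w = w} _ u~w w↝x) with w ≟ᶠ x
  ... | yes refl = _ , symmetric u~w , here u∉S
  ... | no w≢x = extend (escape x∈S S⊆x∪T w∉S w↝x)
    where
    extend : ∃[ z ] (Adj x z × Reach G S w z) → ∃[ z ] (Adj x z × Reach G S u z)
    extend (z , x~z , w↝z) = z , x~z , step u∉S u~w w↝z
    w∉S : w ∉ S
    w∉S w∈S with x∈p∪q⁻ ⁅ x ⁆ _ (S⊆x∪T w∈S)
    ... | inj₁ w∈x = w≢x (x∈⁅y⁆⇒x≡y x w∈x)
    ... | inj₂ w∈T = reach-start w↝x w∈T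

  neighbours≤degree : ∀ {x zs} → Unique zs → All (Adj x) zs → length zs ≤ degree G x
  neighbours≤degree {x} zs-unique x~zs = unique-⊆-length zs-unique
    (λ z∈zs → ∈-filter⁺ (adj? x) (∈-allFin _) (All.lookup x~zs z∈zs))

  low-degree-neighbours : ∀ {x zu zv w} → ¬ (3 ≤ degree G x) → zu ≢ zv →
    Adj x zu → Adj x zv → Adj x w → w ∈ ⁅ zu ⁆ ∪ ⁅ zv ⁆
  low-degree-neighbours {zu = zu} {zv} {w} low zu≢zv x~zu x~zv x~w with w ≟ᶠ zu | w ≟ᶠ zv
  ... | yes refl | _ = x∈p∪q⁺ (inj₁ (x∈⁅x⁆ zu))
  ... | no _ | yes refl = x∈p∪q⁺ (inj₂ (x∈⁅x⁆ zv))
  ... | no w≢zu | no w≢zv = ⊥-elim (low (neighbours≤degree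
          ((zu≢zv ∷ (λ e → w≢zu (sym e)) ∷ []) ∷ ((λ e → w≢zv (sym e)) ∷ []) ∷ [] ∷ [])
          (x~zu ∷ x~zv ∷ x~w ∷ [])))

  -- Parts A, A' of an 𝔖-decomposition: if every cutset T ∈ 𝔖 not containing A
  -- leaves a vertex of A' connected to A in G − T, then A' ⊆ A (a vertex of A' ∖ A
  -- would be separated from A by some T, which would then split A').
  part-⊆ : ∀ {𝔖 A A'} → IsPart G 𝔖 A → IsPart G 𝔖 A' →
    (∀ T → 𝔖 T → ¬ (A ⊆ T) → ∃[ w ] ∃[ a ] (w ∈ A' × a ∈ A × Reach G T w a)) → A' ⊆ A
  part-⊆ {A = A} (_ , separated) (unsplit' , _) linked {v} v∈A' with v ∈? A
  ... | yes v∈A = v∈A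
  ... | no v∉A with T , T∈𝔖 , A⊈T , v⊈T , separates ← separated v v∉A
               with w , a , w∈A' , a∈A , w↝a ← linked T T∈𝔖 A⊈T =
    ⊥-elim (unsplit' T T∈𝔖 (w , v , w∈A' , reach-start w↝a , v∈A' , v∉T ,
      λ w↝v → separates a v a∈A (reach-end w↝a) (x∈⁅x⁆ v) v∉T (reach-trans (reach-sym w↝a) w↝v)))
    where
    v∉T : v ∉ T
    v∉T v∈T = v⊈T (λ u∈v → subst (_∈ T) (sym (x∈⁅y⁆⇒x≡y v u∈v)) v∈T)

module SingleCutset {n : ℕ} (G : Graph n) (biconnected : Biconnected G)
                    (S : Subset n) (single : Single G S) (x : Fin n) (x∈S : x ∈ S) where
  open Graph G
  open GraphFacts G
  open DecList (≡-dec {n = n} _≟ᵇ_) using () renaming (_∈?_ to _∈ᴸ?_)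

  ∣S∣≡2 : ∣ S ∣ ≡ 2
  ∣S∣≡2 = proj₂ (proj₁ single)

  other : ∃[ y ] (y ∈ S × y ≢ x)
  other = let y , y∈S , y∉x = ⊈⇒∃ S⊈x in
          y , y∈S , λ y≡x → y∉x (subst (_∈ ⁅ x ⁆) (sym y≡x) (x∈⁅x⁆ x))
    where
    S⊈x : ¬ (S ⊆ ⁅ x ⁆)
    S⊈x S⊆x with subst₂ _≤_ ∣S∣≡2 (∣⁅x⁆∣≡1 x) (p⊆q⇒∣p∣≤∣q∣ S⊆x)
    ... | s≤s ()

  y : Fin n
  y = proj₁ other

  y∈S : y ∈ S
  y∈S = proj₁ (proj₂ other)

  y≢x : y ≢ x
  y≢x = proj₂ (proj₂ other)

  S⊆xy : S ⊆ ⁅ x ⁆ ∪ ⁅ y ⁆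
  S⊆xy = ⊆-card⇒⊇ xy⊆S
    (≤-reflexive (trans ∣S∣≡2 (sym (∣pair∣≡2 x y (λ x≡y → y≢x (sym x≡y))))))
    where
    xy⊆S : ⁅ x ⁆ ∪ ⁅ y ⁆ ⊆ S
    xy⊆S z∈xy with ∈pair⇒ z∈xy
    ... | inj₁ refl = x∈S
    ... | inj₂ refl = y∈S

  adjacent-in-S : ∀ {a b} → a ∈ S → b ∈ S → a ≢ b → Adj a b → Adj x y
  adjacent-in-S a∈S b∈S a≢b a~b with ∈pair⇒ (S⊆xy a∈S) | ∈pair⇒ (S⊆xy b∈S)
  ... | inj₁ refl | inj₁ refl = ⊥-elim (a≢b refl)
  ... | inj₁ refl | inj₂ refl = a~b
  ... | inj₂ refl | inj₁ refl = symmetric a~b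
  ... | inj₂ refl | inj₂ refl = ⊥-elim (a≢b refl)

  -- Every vertex outside S is attached to x: some neighbour of x lies in its
  -- component of G − S.  (G − y is connected since G is biconnected.)
  attachment : ∀ {u} → u ∉ S → ¬ ¬ (∃[ z ] (Adj x z × Reach G S u z))
  attachment {u} u∉S no-attachment =
    proj₂ biconnected ⁅ y ⁆ (≤-reflexive (∣⁅x⁆∣≡1 y))
      (u , x , u∉y , x≢y⇒x∉⁅y⁆ (λ x≡y → y≢x (sym x≡y)) ,
       λ u↝x → no-attachment (escape x∈S S⊆xy u∉S u↝x))
    where
    u∉y : u ∉ ⁅ y ⁆
    u∉y u∈y = u∉S (subst (_∈ S) (sym (x∈⁅y⁆⇒x≡y y u∈y)) y∈S)

  OuterNeighbour : Fin n → Set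
  OuterNeighbour z = Adj x z × z ∉ S

  -- The two sides of the cutset S give two distinct outer neighbours of x.
  two-neighbours : ¬ ¬ (∃[ zu ] ∃[ zv ] (zu ≢ zv × OuterNeighbour zu × OuterNeighbour zv))
  two-neighbours = separated-sides (proj₁ (proj₁ single))
    where
    separated-sides : Cutset G S →
      ¬ ¬ (∃[ zu ] ∃[ zv ] (zu ≢ zv × OuterNeighbour zu × OuterNeighbour zv))
    separated-sides (u , v , u∉S , v∉S , u↛v) = do
      zu , x~zu , u↝zu ← attachment u∉S
      zv , x~zv , v↝zv ← attachment v∉S
      pure (zu , zv , (λ { refl → u↛v (reach-trans u↝zu (reach-sym v↝zv)) }) ,
            (x~zu , reach-end u↝zu) , (x~zv , reach-end v↝zv))

  -- Part (2): if d_G(x) ≤ 2, two outer neighbours zu ≠ zv contain all neighbours of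
  -- x, so T = {zu, zv} is a 2-cutset separating x from y, i.e. splitting S.
  low-degree-splits-S : ∀ {zu zv} → ¬ (3 ≤ degree G x) → zu ≢ zv →
    OuterNeighbour zu → OuterNeighbour zv → ⊥
  low-degree-splits-S {zu} {zv} low zu≢zv (x~zu , zu∉S) (x~zv , zv∉S) =
    proj₂ (proj₂ single T T-cutset T≢S) (x , y , x∈S , S∩T=∅ x∈S , y∈S , S∩T=∅ y∈S , x↛y)
    where
    T : Subset n
    T = ⁅ zu ⁆ ∪ ⁅ zv ⁆
    S∩T=∅ : ∀ {w} → w ∈ S → w ∉ T
    S∩T=∅ w∈S w∈T with ∈pair⇒ w∈T
    ... | inj₁ refl = zu∉S w∈S
    ... | inj₂ refl = zv∉S w∈S
    x↛y : ¬ Reach G T x y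
    x↛y = enclosed-unreachable (λ x≡y → y≢x (sym x≡y))
      (λ w x~w → low-degree-neighbours low zu≢zv x~zu x~zv x~w)
    T-cutset : Cutset2 G T
    T-cutset = (x , y , S∩T=∅ x∈S , S∩T=∅ y∈S , x↛y) , ∣pair∣≡2 zu zv zu≢zv
    T≢S : T ≢ S
    T≢S T≡S = zu∉S (subst (zu ∈_) T≡S (x∈p∪q⁺ (inj₁ (x∈⁅x⁆ zu))))

  degree≥3 : 3 ≤ degree G x
  degree≥3 = decidable-stable (3 ≤? degree G x) λ low →
    two-neighbours λ (_ , _ , zu≢zv , zu-outer , zv-outer) → low-degree-splits-S low zu≢zv zu-outer zv-outer

  BTNeighbour : Subset n → Set
  BTNeighbour A = IsPart G (Single G) A × S ⊆ A

  -- Two BT-neighbours of S linked through G − S are nested: for a single cutset T,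
  -- either T = S and the link survives in G − T, or some s ∈ S ⊆ A ∩ A' avoids T.
  linked-⊆ : ∀ {A A' a a'} → BTNeighbour A → BTNeighbour A' → a ∈ A → a' ∈ A' →
    Reach G S a' a → A' ⊆ A
  linked-⊆ {A} {A'} {a} {a'} (A-part , S⊆A) (A'-part , S⊆A') a∈A a'∈A' a'↝a = part-⊆ A-part A'-part link
    where
    link : ∀ T → Single G T → ¬ (A ⊆ T) → ∃[ w ] ∃[ b ] (w ∈ A' × b ∈ A × Reach G T w b)
    link T T-single _ with S ⊆? T
    ... | yes S⊆T = a' , a , a'∈A' , a∈A ,
      reach-mono (⊆-card⇒⊇ S⊆T (≤-reflexive (trans (proj₂ (proj₁ T-single)) (sym ∣S∣≡2)))) a'↝a
    ... | no S⊈T = let s , s∈S , s∉T = ⊈⇒∃ S⊈T in s , s , S⊆A' s∈S , S⊆A s∈S , here s∉T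

  S-part-unique : ∀ {A} → BTNeighbour S → BTNeighbour A → A ≡ S
  S-part-unique {A} (S-part , _) (A-part , S⊆A) = ⊆-antisym (part-⊆ S-part A-part link) S⊆A
    where
    link : ∀ T → Single G T → ¬ (S ⊆ T) → ∃[ w ] ∃[ s ] (w ∈ A × s ∈ S × Reach G T w s)
    link T _ S⊈T = let s , s∈S , s∉T = ⊈⇒∃ S⊈T in s , s , S⊆A s∈S , s∈S , here s∉T

  Attachment : Subset n → Fin n → Set
  Attachment A z = BTNeighbour A × Adj x z × ∃[ a ] (a ∈ A × Reach G S a z)

  attachment-injective : ∀ {A A' z} → Attachment A z → Attachment A' z → A ≡ A'
  attachment-injective (A-bt , _ , a , a∈A , a↝z) (A'-bt , _ , a' , a'∈A' , a'↝z) =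
    ⊆-antisym (linked-⊆ A'-bt A-bt a'∈A' a∈A a↝a') (linked-⊆ A-bt A'-bt a∈A a'∈A' (reach-sym a↝a'))
    where
    a↝a' : Reach G S a a'
    a↝a' = reach-trans a↝z (reach-sym a'↝z)

  has-attachment : ∀ {A} → BTNeighbour A × A ≢ S → ¬ ¬ ∃ (Attachment A)
  has-attachment (A-bt@(_ , S⊆A) , A≢S) = do
    let a , a∈A , a∉S = ⊈⇒∃ (λ A⊆S → A≢S (⊆-antisym A⊆S S⊆A))
    z , x~z , a↝z ← attachment a∉S
    pure (z , A-bt , x~z , a , a∈A , a↝z)

  outer-neighbours : ∀ {d} → BTDegree G S d →
    ¬ ¬ (∃[ zs ] (Unique zs × All OuterNeighbour zs × d ≤ length zs))
  outer-neighbours (As , refl , As-unique , As-bt , _) with S ∈ᴸ? As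
  ... | yes S∈As = do
    zu , zv , zu≢zv , zu-outer , zv-outer ← two-neighbours
    pure (zu ∷ zv ∷ [] , (zu≢zv ∷ []) ∷ [] ∷ [] , zu-outer ∷ zv-outer ∷ [] ,
          ≤-trans (unique-constant-length As-unique all-S) (s≤s z≤n))
    where
    all-S : All (_≡ S) As
    all-S = All.tabulate λ A∈As → S-part-unique (All.lookup As-bt S∈As) (All.lookup As-bt A∈As)
  ... | no S∉As = do
    attached ← All.mapM 0ℓ ¬¬-Monad has-attachment (All.zip (As-bt , All.tabulate S-free))
    let zs , zs-unique , zs-attached , zs-length = witness-list Attachment attachment-injective As-unique attached
    pure (zs , zs-unique , All.map outer zs-attached , ≤-reflexive (sym zs-length))
    where
    S-free : ∀ {A} → A List.∈ As → A ≢ S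
    S-free A∈As A≡S = S∉As (subst (List._∈ As) A≡S A∈As)
    outer : ∀ {z} → ∃ (λ A → A List.∈ As × Attachment A z) → OuterNeighbour z
    outer (_ , _ , _ , x~z , _ , _ , a↝z) = x~z , reach-end a↝z

  outer≤degree : ∀ {zs} → Unique zs → All OuterNeighbour zs → length zs ≤ degree G x
  outer≤degree zs-unique zs-outer = neighbours≤degree zs-unique (All.map proj₁ zs-outer)

  outer<degree : ∀ {zs} → Adj x y → Unique zs → All OuterNeighbour zs → length zs < degree G x
  outer<degree x~y zs-unique zs-outer =
    neighbours≤degree (All.map y≢outer zs-outer ∷ zs-unique) (x~y ∷ All.map proj₁ zs-outer)
    where
    y≢outer : ∀ {z} → OuterNeighbour z → y ≢ z
    y≢outer (_ , z∉S) y≡z = z∉S (subst (_∈ S) y≡z y∈S)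

  bt-degree≤degree : ∀ {d} → BTDegree G S d → d ≤ degree G x
  bt-degree≤degree {d} bt = decidable-stable (d ≤? degree G x) λ d≰deg →
    outer-neighbours bt λ (_ , zs-unique , zs-outer , d≤zs) →
    d≰deg (≤-trans d≤zs (outer≤degree zs-unique zs-outer))

  bt-degree<degree : ∀ {d} → BTDegree G S d → Adj x y → d < degree G x
  bt-degree<degree {d} bt x~y = decidable-stable (suc d ≤? degree G x) λ d≮deg →
    outer-neighbours bt λ (_ , zs-unique , zs-outer , d≤zs) →
    d≮deg (≤-trans (s≤s d≤zs) (outer<degree x~y zs-unique zs-outer))

lemma4 : ∀ {n} (G : Graph n) → Biconnected G → (S : Subset n) → Single G S →
    (x : Fin n) → x ∈ S →
    ((d : ℕ) → BTDegree G S d →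
      d ≤ degree G x ×
      (degree G x ≡ d → ∀ a b → a ∈ S → b ∈ S → a ≢ b → ¬ Graph.Adj G a b))
    × 3 ≤ degree G x
lemma4 G biconnected S single x x∈S = bt-degree , degree≥3
  where
  open SingleCutset G biconnected S single x x∈S
  bt-degree : (d : ℕ) → BTDegree G S d →
    d ≤ degree G x × (degree G x ≡ d → ∀ a b → a ∈ S → b ∈ S → a ≢ b → ¬ Graph.Adj G a b)
  bt-degree d bt = bt-degree≤degree bt , λ deg≡d a b a∈S b∈S a≢b a~b →
    <⇒≢ (bt-degree<degree bt (adjacent-in-S a∈S b∈S a≢b a~b)) (sym deg≡d)
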